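{- Let $q$ be a prime power, $y$ a generator of the cyclic group $GF(q)^\ast$, and $x_0=0,x_1,\dots,x_{q-1}$ a labelling of the elements of $GF(q)$. Let $L^{(q-1)}=(\lambda_{ij})_{0\le i,j\le q}$ be the $\mathbb{Z}_{q-1}$-scheme of order $q+1$ defined by: $\lambda_{ii}=\emptyset$; $\lambda_{ij}=\{0\}$ if exactly one of $i,j$ equals $q$; and, for $i,j\in\{0,\dots,q-1\}$ with $i\ne j$, $\lambda_{ij}=\{z\}$ where $z\in\mathbb{Z}_{q-1}$ is such that $x_i-x_j=y^z$. Then $L^{(q-1)}$ is $J_2$-free.
   Context: A $\mathbb{Z}_\mu$-scheme is a rectangular array of subsets of $\mathbb{Z}_\mu$. For $C\subseteq\mathbb{Z}_\mu$, $\overline C$ is the circulant $(0,1)$-matrix of order $\mu$ (indices $0,\dots,\mu-1$) with entry $1$ at $(i,j)$ iff $j-i\pmod\mu\in C$; the blow-up of a scheme $(S_{ij})$ is the block matrix with blocks $\overline{S_{ij}}$. A scheme is $J_2$-free if every $2\times 2$ submatrix (two distinct rows, two distinct columns) of its blow-up contains an entry $0$. -}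

module Defs where

open import Level using (Level; _⊔_) renaming (suc to lsuc)
open import Data.Nat using (ℕ; zero; suc; _+_; _^_; _≤_)
open import Data.Nat.Primality using (Prime)
open import Data.Fin using (Fin; zero; suc; toℕ)
open import Data.Maybe using (Maybe; just; nothing)
import Data.Maybe as Maybe
open import Data.Product using (Σ; ∃; _×_; _,_)
open import Data.Sum using (_⊎_)
open import Data.Empty using (⊥)
open import Relation.Nullary using (¬_)
open import Relation.Binary.PropositionalEquality using (_≡_; _≢_)
open import Algebra.Bundles using (CommutativeRing)

IsPrimePower : ℕ → Set
IsPrimePower q = Σ ℕ λ p → Σ ℕ λ k → Prime p × 1 ≤ k × q ≡ p ^ k

IsField : ∀ {c ℓ} → CommutativeRing c ℓ → Set (c ⊔ ℓ)
IsField R = ¬ (1# ≈ 0#) × (∀ a → ¬ (a ≈ 0#) → Σ Carrier λ b → a * b ≈ 1#)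
  where open CommutativeRing R

pow : ∀ {c ℓ} (R : CommutativeRing c ℓ) → CommutativeRing.Carrier R → ℕ → CommutativeRing.Carrier R
pow R y zero = CommutativeRing.1# R
pow R y (suc n) = CommutativeRing._*_ R y (pow R y n)

IsLabelling : ∀ {c ℓ} (R : CommutativeRing c ℓ) (q : ℕ) → (Fin q → CommutativeRing.Carrier R) → Set (c ⊔ ℓ)
IsLabelling R q x =
  (∀ i j → x i ≈ x j → i ≡ j) ×
  (∀ a → Σ (Fin q) λ i → x i ≈ a) ×
  (∀ (i : Fin q) → toℕ i ≡ 0 → x i ≈ 0#)
  where open CommutativeRing R

IsGenerator : ∀ {c ℓ} (R : CommutativeRing c ℓ) → CommutativeRing.Carrier R → Set (c ⊔ ℓ)
IsGenerator R y = ¬ (y ≈ 0#) × (∀ a → ¬ (a ≈ 0#) → Σ ℕ λ z → a ≈ pow R y z)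
  where open CommutativeRing R

-- A Z_μ-scheme with m rows and n columns: each entry is a subset of Z_μ = Fin μ,
-- given as a predicate.
Scheme : ∀ ℓ → ℕ → ℕ → ℕ → Set (lsuc ℓ)
Scheme ℓ m n μ = Fin m → Fin n → Fin μ → Set ℓ

-- Entry (a,b) of the circulant matrix C̄ is 1 iff (b - a mod μ) ∈ C,
-- i.e. there is k ∈ C with a + k ≡ b (mod μ); since a,k,b < μ this means
-- a + k = b or a + k = b + μ.
CircEntry : ∀ {ℓ μ} → (Fin μ → Set ℓ) → Fin μ → Fin μ → Set ℓ
CircEntry {μ = μ} C a b =
  Σ (Fin μ) λ k → C k × ((toℕ a + toℕ k ≡ toℕ b) ⊎ (toℕ a + toℕ k ≡ toℕ b + μ))

BlowUp : ∀ {ℓ m n μ} → Scheme ℓ m n μ → Fin m × Fin μ → Fin n × Fin μ → Set ℓ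
BlowUp S (i , a) (j , b) = CircEntry (S i j) a b

J2Free : ∀ {ℓ m n μ} → Scheme ℓ m n μ → Set ℓ
J2Free {m = m} {n} {μ} S =
  ∀ (r₁ r₂ : Fin m × Fin μ) (c₁ c₂ : Fin n × Fin μ) → r₁ ≢ r₂ → c₁ ≢ c₂ →
  ¬ (BlowUp S r₁ c₁ × BlowUp S r₁ c₂ × BlowUp S r₂ c₁ × BlowUp S r₂ c₂)

-- Index view of Fin (suc q): the last index q ↦ nothing, index i < q ↦ just i.
view : ∀ {q} → Fin (suc q) → Maybe (Fin q)
view {zero} zero = nothing
view {suc q} zero = just zero
view {suc q} (suc i) = Maybe.map suc (view i)

LEntry : ∀ {c ℓ} (R : CommutativeRing c ℓ) (q : ℕ) (x : Fin q → CommutativeRing.Carrier R)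
         (y : CommutativeRing.Carrier R) {μ : ℕ} → Maybe (Fin q) → Maybe (Fin q) → Fin μ → Set ℓ
LEntry R q x y (just i) (just j) k = i ≢ j × (x i - x j ≈ pow R y (toℕ k))
  where open CommutativeRing R
LEntry R q x y (just i) nothing k = Level.Lift _ (toℕ k ≡ 0)
LEntry R q x y nothing (just j) k = Level.Lift _ (toℕ k ≡ 0)
LEntry R q x y nothing nothing k = Level.Lift _ ⊥

L : ∀ {c ℓ} (R : CommutativeRing c ℓ) (q : ℕ) (x : Fin q → CommutativeRing.Carrier R)
    (y : CommutativeRing.Carrier R) → Scheme ℓ (suc q) (suc q) (q Data.Nat.∸ 1)
L R q x y i j k = LEntry R q x y (view i) (view j) k

module Submission where

-- The scheme L^(q-1) is the point/line incidence structure of an affine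
-- plane over the field K = GF(q), read through the blow-up.
--
-- Send the row (i , a) of the blow-up to the point (y^a , y^a·x_i) of K²
-- (to (0 , y^a) for the extra block row i = q), and the column (j , b) to
-- the line  B − A·x_j = y^b  (to the vertical line A = y^b for j = q).
-- Because y has multiplicative order exactly q − 1, a 1 in the blow-up at
-- ((i , a) , (j , b)) means that the point of the row lies on the line of
-- the column; and distinct rows / columns give distinct points / lines.
-- A 2×2 all-ones submatrix would therefore be two distinct points on two
-- distinct lines, which cannot exist in a plane over a field.

open import Defs
open import Data.Nat using (ℕ)
open import Data.Fin using (Fin)
open import Algebra.Bundles using (CommutativeRing)

open import Level using (Lift; lift)
open import Data.Nat as ℕ using (zero; suc; _≤_; _<_)
import Data.Nat.Properties as ℕₚ
open import Data.Nat.DivMod using (_%_; _/_; m≡m%n+[m/n]*n; m%n<n)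
open import Data.Fin as Fin using (toℕ; fromℕ<)
import Data.Fin.Properties as Finₚ
open import Data.Maybe using (Maybe; just; nothing)
import Data.Maybe as Maybe
import Data.Maybe.Properties as Maybeₚ
open import Data.Product using (Σ; _×_; _,_; proj₁; proj₂)
open import Data.Product.Relation.Binary.Pointwise.NonDependent using (Pointwise)
open import Data.Sum using (inj₁; inj₂)
open import Data.Empty using (⊥; ⊥-elim)
open import Function using (_∘_)
open import Relation.Nullary using (¬_)
open import Relation.Binary.PropositionalEquality as ≡ using (_≡_; _≢_; refl; cong; cong₂)
open import Relation.Binary.Definitions using (tri<; tri≈; tri>)
import Algebra.Definitions
import Algebra.Consequences.Setoid
import Algebra.Properties.AbelianGroup
import Algebra.Properties.Ring

view-injective : ∀ {q} (i j : Fin (suc q)) → view i ≡ view j → i ≡ j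
view-injective {zero}  Fin.zero    Fin.zero    _  = refl
view-injective {suc q} Fin.zero    Fin.zero    _  = refl
view-injective {suc q} Fin.zero    (Fin.suc j) eq = ⊥-elim (just≢map-suc (view j) eq)
  where
  just≢map-suc : ∀ (m : Maybe (Fin q)) → just Fin.zero ≢ Maybe.map Fin.suc m
  just≢map-suc nothing  ()
  just≢map-suc (just _) ()
view-injective {suc q} (Fin.suc i) Fin.zero    eq = ≡.sym (view-injective Fin.zero (Fin.suc i) (≡.sym eq))
view-injective {suc q} (Fin.suc i) (Fin.suc j) eq =
  cong Fin.suc (view-injective i j (Maybeₚ.map-injective Finₚ.suc-injective eq))

view-pair-injective : ∀ {q n} {i i′ : Fin (suc q)} {a a′ : Fin n} →
                      view i ≡ view i′ × a ≡ a′ → (i , a) ≡ (i′ , a′)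
view-pair-injective {i = i} {i′} (view-eq , a≡a′) = cong₂ _,_ (view-injective i i′ view-eq) a≡a′

module FieldTheory {c ℓ} (R : CommutativeRing c ℓ) (isField : IsField R) where
  open CommutativeRing R renaming (refl to ≈-refl)
  open Algebra.Definitions _≈_ using (AlmostLeftCancellative; AlmostRightCancellative)
  open Algebra.Properties.AbelianGroup +-abelianGroup
    using (x∙y⁻¹≈ε⇒x≈y; ⁻¹-anti-homo‿-; \\-leftDividesʳ; ∙-cancelʳ)
  open Algebra.Properties.Ring ring using (x[y-z]≈xy-xz)
  open import Relation.Binary.Reasoning.Setoid setoid

  1≉0 : ¬ 1# ≈ 0#
  1≉0 = proj₁ isField

  *-cancelˡ-nonZero : AlmostLeftCancellative 0# _*_
  *-cancelˡ-nonZero a b d a≉0 ab≈ad with proj₂ isField a a≉0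
  ... | a⁻¹ , aa⁻¹≈1 = begin
    b               ≈⟨ *-identityˡ b ⟨
    1# * b          ≈⟨ *-congʳ (trans (sym aa⁻¹≈1) (*-comm a a⁻¹)) ⟩
    (a⁻¹ * a) * b   ≈⟨ *-assoc a⁻¹ a b ⟩
    a⁻¹ * (a * b)   ≈⟨ *-congˡ ab≈ad ⟩
    a⁻¹ * (a * d)   ≈⟨ *-assoc a⁻¹ a d ⟨
    (a⁻¹ * a) * d   ≈⟨ *-congʳ (trans (*-comm a⁻¹ a) aa⁻¹≈1) ⟩
    1# * d          ≈⟨ *-identityˡ d ⟩
    d               ∎

  *-cancelʳ-nonZero : AlmostRightCancellative 0# _*_
  *-cancelʳ-nonZero =
    Algebra.Consequences.Setoid.comm∧almostCancelˡ⇒almostCancelʳ setoid *-comm *-cancelˡ-nonZero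

  *-nonZero : ∀ {a b} → ¬ a ≈ 0# → ¬ b ≈ 0# → ¬ a * b ≈ 0#
  *-nonZero {a} {b} a≉0 b≉0 ab≈0 =
    b≉0 (*-cancelˡ-nonZero a b 0# a≉0 (trans ab≈0 (sym (zeroʳ a))))

  -‿nonZero : ∀ {u v} → ¬ u ≈ v → ¬ u - v ≈ 0#
  -‿nonZero {u} {v} u≉v = u≉v ∘ x∙y⁻¹≈ε⇒x≈y u v

  sub-sub-cancel : ∀ b u v → (b - u) - (b - v) ≈ v - u
  sub-sub-cancel b u v = begin
    (b - u) + - (b - v)   ≈⟨ +-congˡ (⁻¹-anti-homo‿- b v) ⟩
    (b - u) + (v - b)     ≈⟨ +-comm (b - u) (v - b) ⟩
    (v - b) + (b - u)     ≈⟨ +-assoc v (- b) (b - u) ⟩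
    v + (- b + (b - u))   ≈⟨ +-congˡ (\\-leftDividesʳ b (- u)) ⟩
    v - u                 ∎

  module Powers (y : Carrier) (y≉0 : ¬ y ≈ 0#) where

    Y : ℕ → Carrier
    Y = pow R y

    Y-nonZero : ∀ k → ¬ Y k ≈ 0#
    Y-nonZero zero    = 1≉0
    Y-nonZero (suc k) = *-nonZero y≉0 (Y-nonZero k)

    Y-+ : ∀ m n → Y (m ℕ.+ n) ≈ Y m * Y n
    Y-+ zero    n = sym (*-identityˡ (Y n))
    Y-+ (suc m) n = trans (*-congˡ (Y-+ m n)) (sym (*-assoc y (Y m) (Y n)))

    equal-powers⇒period : ∀ i d → Y i ≈ Y (i ℕ.+ d) → Y d ≈ 1#
    equal-powers⇒period i d Yi≈Yi+d = *-cancelˡ-nonZero (Y i) (Y d) 1# (Y-nonZero i) (begin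
      Y i * Y d       ≈⟨ Y-+ i d ⟨
      Y (i ℕ.+ d)     ≈⟨ Yi≈Yi+d ⟨
      Y i             ≈⟨ *-identityʳ (Y i) ⟨
      Y i * 1#        ∎)

    repeated-power⇒period : ∀ {m n} → m < n → Y m ≈ Y n → Σ ℕ λ d → suc d ≤ n × Y (suc d) ≈ 1#
    repeated-power⇒period {m} {n} m<n Ym≈Yn with ℕₚ.m≤n⇒∃[o]m+o≡n m<n
    ... | d , m+1+d≡n = d , d+1≤n , equal-powers⇒period m (suc d) (trans Ym≈Yn (reflexive (cong Y n≡m+d+1)))
      where
      n≡m+d+1 : n ≡ m ℕ.+ suc d
      n≡m+d+1 = ≡.trans (≡.sym m+1+d≡n) (≡.sym (ℕₚ.+-suc m d))
      d+1≤n : suc d ≤ n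
      d+1≤n = ℕₚ.≤-trans (ℕₚ.m≤n+m (suc d) m) (ℕₚ.≤-reflexive (≡.sym n≡m+d+1))

    module Period (d : ℕ) .{{_ : ℕ.NonZero d}} (Yd≈1 : Y d ≈ 1#) where

      Y-multiple : ∀ m → Y (m ℕ.* d) ≈ 1#
      Y-multiple zero    = ≈-refl
      Y-multiple (suc m) = begin
        Y (d ℕ.+ m ℕ.* d)     ≈⟨ Y-+ d (m ℕ.* d) ⟩
        Y d * Y (m ℕ.* d)     ≈⟨ *-cong Yd≈1 (Y-multiple m) ⟩
        1# * 1#               ≈⟨ *-identityˡ 1# ⟩
        1#                    ∎

      Y-mod : ∀ z → Y z ≈ Y (z % d)
      Y-mod z = begin
        Y z                                ≡⟨ cong Y (m≡m%n+[m/n]*n z d) ⟩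
        Y (z % d ℕ.+ (z / d) ℕ.* d)        ≈⟨ Y-+ (z % d) ((z / d) ℕ.* d) ⟩
        Y (z % d) * Y ((z / d) ℕ.* d)      ≈⟨ *-congˡ (Y-multiple (z / d)) ⟩
        Y (z % d) * 1#                     ≈⟨ *-identityʳ (Y (z % d)) ⟩
        Y (z % d)                          ∎

    circulant-step : ∀ {ℓ′} μ → Y μ ≈ 1# → {C : Fin μ → Set ℓ′} {a b : Fin μ} →
                     CircEntry C a b → Σ (Fin μ) λ k → C k × Y (toℕ a) * Y (toℕ k) ≈ Y (toℕ b)
    circulant-step μ Yμ≈1 {a = a} {b} (k , k∈C , inj₁ a+k≡b) =
      k , k∈C , trans (sym (Y-+ (toℕ a) (toℕ k))) (reflexive (cong Y a+k≡b))
    circulant-step μ Yμ≈1 {a = a} {b} (k , k∈C , inj₂ a+k≡b+μ) = k , k∈C , (begin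
      Y (toℕ a) * Y (toℕ k)   ≈⟨ Y-+ (toℕ a) (toℕ k) ⟨
      Y (toℕ a ℕ.+ toℕ k)     ≡⟨ cong Y a+k≡b+μ ⟩
      Y (toℕ b ℕ.+ μ)         ≈⟨ Y-+ (toℕ b) μ ⟩
      Y (toℕ b) * Y μ         ≈⟨ *-congˡ Yμ≈1 ⟩
      Y (toℕ b) * 1#          ≈⟨ *-identityʳ (Y (toℕ b)) ⟩
      Y (toℕ b)               ∎)

    -- If e : Fin N → K lists the N elements of K* without repetition and y
    -- generates K*, then y has order exactly N: y^N = 1, and y^0, …, y^(N-1)
    -- are pairwise distinct.
    module CyclicOrder (N : ℕ) (e : Fin N → Carrier)
      (e-injective : ∀ i j → e i ≈ e j → i ≡ j)
      (e-nonZero : ∀ k → ¬ e k ≈ 0#)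
      (e-covers : ∀ a → ¬ a ≈ 0# → Σ (Fin N) λ k → e k ≈ a)
      (y-generates : ∀ a → ¬ a ≈ 0# → Σ ℕ λ z → a ≈ Y z) where

      log : Fin N → ℕ
      log k = proj₁ (y-generates (e k) (e-nonZero k))

      log-spec : ∀ k → e k ≈ Y (log k)
      log-spec k = proj₂ (y-generates (e k) (e-nonZero k))

      -- A positive period is at least N: reducing the logarithms modulo the
      -- period maps K* injectively into Fin period.
      period-bound : ∀ d → Y (suc d) ≈ 1# → N ≤ suc d
      period-bound d Yd≈1 = Finₚ.injective⇒≤ {f = log-mod} log-mod-injective
        where
        open Period (suc d) Yd≈1
        log-mod : Fin N → Fin (suc d)
        log-mod k = fromℕ< (m%n<n (log k) (suc d))
        log-mod-injective : ∀ {i j} → log-mod i ≡ log-mod j → i ≡ j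
        log-mod-injective {i} {j} eq = e-injective i j (begin
          e i                      ≈⟨ log-spec i ⟩
          Y (log i)                ≈⟨ Y-mod (log i) ⟩
          Y (log i % suc d)        ≡⟨ cong Y (Finₚ.fromℕ<-injective _ _ _ _ eq) ⟩
          Y (log j % suc d)        ≈⟨ Y-mod (log j) ⟨
          Y (log j)                ≈⟨ log-spec j ⟨
          e j                      ∎)

      power-index : ℕ → Fin N
      power-index k = proj₁ (e-covers (Y k) (Y-nonZero k))

      power-index-spec : ∀ k → e (power-index k) ≈ Y k
      power-index-spec k = proj₂ (e-covers (Y k) (Y-nonZero k))

      -- Among the N + 1 powers y^0, …, y^N two coincide (pigeonhole into
      -- K*), so some period d + 1 ≤ N exists.
      small-period : Σ ℕ λ d → suc d ≤ N × Y (suc d) ≈ 1#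
      small-period with Finₚ.pigeonhole (ℕₚ.n<1+n N) (power-index ∘ toℕ)
      ... | i , j , i<j , same-index with repeated-power⇒period i<j Yi≈Yj
        where
        Yi≈Yj : Y (toℕ i) ≈ Y (toℕ j)
        Yi≈Yj = begin
          Y (toℕ i)                  ≈⟨ power-index-spec (toℕ i) ⟨
          e (power-index (toℕ i))    ≡⟨ cong e same-index ⟩
          e (power-index (toℕ j))    ≈⟨ power-index-spec (toℕ j) ⟩
          Y (toℕ j)                  ∎
      ... | d , d+1≤j , period = d , ℕₚ.≤-trans d+1≤j (ℕₚ.≤-pred (Finₚ.toℕ<n j)) , period

      Y-order : Y N ≈ 1#
      Y-order with small-period
      ... | d , d+1≤N , Yd+1≈1 =
        trans (reflexive (cong Y (ℕₚ.≤-antisym (period-bound d Yd+1≈1) d+1≤N))) Yd+1≈1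

      no-short-period : ∀ m n → m < n → n < N → Y m ≈ Y n → ⊥
      no-short-period m n m<n n<N Ym≈Yn with repeated-power⇒period m<n Ym≈Yn
      ... | d , d+1≤n , period = ℕₚ.<⇒≱ (ℕₚ.≤-<-trans d+1≤n n<N) (period-bound d period)

      Y-injective : ∀ (a b : Fin N) → Y (toℕ a) ≈ Y (toℕ b) → a ≡ b
      Y-injective a b Ya≈Yb with ℕₚ.<-cmp (toℕ a) (toℕ b)
      ... | tri< a<b _ _ = ⊥-elim (no-short-period (toℕ a) (toℕ b) a<b (Finₚ.toℕ<n b) Ya≈Yb)
      ... | tri≈ _ a≡b _ = Finₚ.toℕ-injective a≡b
      ... | tri> _ _ b<a = ⊥-elim (no-short-period (toℕ b) (toℕ a) b<a (Finₚ.toℕ<n a) (sym Ya≈Yb))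

  module AffinePlane where

    Point : Set c
    Point = Carrier × Carrier

    _≋_ : Point → Point → Set ℓ
    _≋_ = Pointwise _≈_ _≈_

    data Line : Set c where
      slope    : (m β : Carrier) → Line
      vertical : (β : Carrier) → Line

    _on_ : Point → Line → Set ℓ
    (A , B) on slope m β  = B - A * m ≈ β
    (A , B) on vertical β = A ≈ β

    SameLine : Line → Line → Set ℓ
    SameLine (slope m β)  (slope m′ β′)  = m ≈ m′ × β ≈ β′
    SameLine (vertical β) (vertical β′)  = β ≈ β′
    SameLine _            _              = Lift ℓ ⊥

    same-abscissa : ∀ {A B A′ B′ m β} → A ≈ A′ →
                    (A , B) on slope m β → (A′ , B′) on slope m β → (A , B) ≋ (A′ , B′)
    same-abscissa {A} {B} {A′} {B′} {m} {β} A≈A′ P-on Q-on = A≈A′ , ∙-cancelʳ (- (A * m)) B B′ (begin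
      B - A * m     ≈⟨ P-on ⟩
      β             ≈⟨ Q-on ⟨
      B′ - A′ * m   ≈⟨ +-congˡ (-‿cong (*-congʳ A≈A′)) ⟨
      B′ - A * m    ∎)

    abscissa-by-slopes : ∀ {A B m β m′ β′} →
                         (A , B) on slope m β → (A , B) on slope m′ β′ → A * (m - m′) ≈ β′ - β
    abscissa-by-slopes {A} {B} {m} {β} {m′} {β′} on₁ on₂ = begin
      A * (m - m′)                      ≈⟨ x[y-z]≈xy-xz A m m′ ⟩
      A * m - A * m′                    ≈⟨ sub-sub-cancel B (A * m′) (A * m) ⟨
      (B - A * m′) - (B - A * m)        ≈⟨ +-cong on₂ (-‿cong on₁) ⟩
      β′ - β                            ∎

    distinct-lines-meet-once : ∀ {P Q} l₁ l₂ → ¬ SameLine l₁ l₂ →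
                               P on l₁ → P on l₂ → Q on l₁ → Q on l₂ → P ≋ Q
    distinct-lines-meet-once {A , B} {A′ , B′} (slope m β) (slope m′ β′) l₁≠l₂ P-on₁ P-on₂ Q-on₁ Q-on₂ =
      same-abscissa A≈A′ P-on₁ Q-on₁
      where
      m≉m′ : ¬ m ≈ m′
      m≉m′ m≈m′ = l₁≠l₂ (m≈m′ , (begin
        β            ≈⟨ P-on₁ ⟨
        B - A * m    ≈⟨ +-congˡ (-‿cong (*-congˡ m≈m′)) ⟩
        B - A * m′   ≈⟨ P-on₂ ⟩
        β′           ∎))
      A≈A′ : A ≈ A′
      A≈A′ = *-cancelʳ-nonZero (m - m′) A A′ (-‿nonZero m≉m′)
               (trans (abscissa-by-slopes P-on₁ P-on₂) (sym (abscissa-by-slopes Q-on₁ Q-on₂)))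
    distinct-lines-meet-once (slope m β) (vertical β′) _ P-on₁ P-on₂ Q-on₁ Q-on₂ =
      same-abscissa (trans P-on₂ (sym Q-on₂)) P-on₁ Q-on₁
    distinct-lines-meet-once (vertical β) (slope m′ β′) _ P-on₁ P-on₂ Q-on₁ Q-on₂ =
      same-abscissa (trans P-on₁ (sym Q-on₁)) P-on₂ Q-on₂
    distinct-lines-meet-once (vertical β) (vertical β′) l₁≠l₂ P-on₁ P-on₂ _ _ =
      ⊥-elim (l₁≠l₂ (trans (sym P-on₁) P-on₂))

module BlowUpGeometry {c ℓ} (R : CommutativeRing c ℓ) (isField : IsField R) (N : ℕ)
  (x : Fin (suc N) → CommutativeRing.Carrier R) (x-labels : IsLabelling R (suc N) x)
  (y : CommutativeRing.Carrier R) (y-generates : IsGenerator R y) where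

  open CommutativeRing R hiding (refl)
  open FieldTheory R isField
  open Powers y (proj₁ y-generates)
  open AffinePlane
  open Algebra.Properties.AbelianGroup +-abelianGroup using (ε⁻¹≈ε)
  open Algebra.Properties.Ring ring using (x[y-z]≈xy-xz)
  open import Relation.Binary.Reasoning.Setoid setoid

  x-injective : ∀ i j → x i ≈ x j → i ≡ j
  x-injective = proj₁ x-labels

  x-zero : x Fin.zero ≈ 0#
  x-zero = proj₂ (proj₂ x-labels) Fin.zero refl

  x-nonZero : ∀ k → ¬ x (Fin.suc k) ≈ 0#
  x-nonZero k xk≈0 with x-injective (Fin.suc k) Fin.zero (trans xk≈0 (sym x-zero))
  ... | ()

  x-covers : ∀ a → ¬ a ≈ 0# → Σ (Fin N) λ k → x (Fin.suc k) ≈ a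
  x-covers a a≉0 = nonzero-label (proj₁ (proj₂ x-labels) a)
    where
    nonzero-label : Σ (Fin (suc N)) (λ i → x i ≈ a) → Σ (Fin N) λ k → x (Fin.suc k) ≈ a
    nonzero-label (Fin.zero  , x₀≈a) = ⊥-elim (a≉0 (trans (sym x₀≈a) x-zero))
    nonzero-label (Fin.suc k , xk≈a) = k , xk≈a

  open CyclicOrder N (x ∘ Fin.suc) (λ i j → Finₚ.suc-injective ∘ x-injective (Fin.suc i) (Fin.suc j))
                     x-nonZero x-covers (proj₂ y-generates)

  pointAt : Maybe (Fin (suc N)) → Fin N → Point
  pointAt (just i) a = Y (toℕ a) , Y (toℕ a) * x i
  pointAt nothing  a = 0# , Y (toℕ a)

  lineAt : Maybe (Fin (suc N)) → Fin N → Line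
  lineAt (just j) b = slope (x j) (Y (toℕ b))
  lineAt nothing  b = vertical (Y (toℕ b))

  unit-step : ∀ {a b k : Fin N} → toℕ k ≡ 0 → Y (toℕ a) * Y (toℕ k) ≈ Y (toℕ b) → Y (toℕ a) ≈ Y (toℕ b)
  unit-step {a} k≡0 step = trans (sym (trans (*-congˡ (reflexive (cong Y k≡0))) (*-identityʳ (Y (toℕ a))))) step

  incident : ∀ U V {a b} → CircEntry (LEntry R (suc N) x y U V) a b → pointAt U a on lineAt V b
  incident (just i) (just j) {a} {b} entry with circulant-step N Y-order entry
  ... | k , (_ , xᵢ-xⱼ≈Yk) , step = begin
    Y (toℕ a) * x i - Y (toℕ a) * x j   ≈⟨ x[y-z]≈xy-xz (Y (toℕ a)) (x i) (x j) ⟨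
    Y (toℕ a) * (x i - x j)             ≈⟨ *-congˡ xᵢ-xⱼ≈Yk ⟩
    Y (toℕ a) * Y (toℕ k)               ≈⟨ step ⟩
    Y (toℕ b)                           ∎
  incident (just i) nothing {a} {b} entry with circulant-step N Y-order entry
  ... | k , lift k≡0 , step = unit-step {a} {b} k≡0 step
  incident nothing (just j) {a} {b} entry with circulant-step N Y-order entry
  ... | k , lift k≡0 , step = begin
    Y (toℕ a) - 0# * x j   ≈⟨ +-congˡ (-‿cong (zeroˡ (x j))) ⟩
    Y (toℕ a) - 0#         ≈⟨ +-congˡ ε⁻¹≈ε ⟩
    Y (toℕ a) + 0#         ≈⟨ +-identityʳ (Y (toℕ a)) ⟩
    Y (toℕ a)              ≈⟨ unit-step {a} {b} k≡0 step ⟩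
    Y (toℕ b)              ∎
  incident nothing nothing (_ , lift () , _)

  pointAt-injective : ∀ U U′ a a′ → pointAt U a ≋ pointAt U′ a′ → U ≡ U′ × a ≡ a′
  pointAt-injective (just i) (just i′) a a′ (Ya≈Ya′ , Yaxᵢ≈Ya′xᵢ′) with Y-injective a a′ Ya≈Ya′
  ... | refl = cong just (x-injective i i′ (*-cancelˡ-nonZero (Y (toℕ a)) (x i) (x i′) (Y-nonZero (toℕ a)) Yaxᵢ≈Ya′xᵢ′)) , refl
  pointAt-injective (just i) nothing  a a′ (Ya≈0 , _)   = ⊥-elim (Y-nonZero (toℕ a) Ya≈0)
  pointAt-injective nothing (just i′) a a′ (0≈Ya′ , _)  = ⊥-elim (Y-nonZero (toℕ a′) (sym 0≈Ya′))
  pointAt-injective nothing nothing   a a′ (_ , Ya≈Ya′) = refl , Y-injective a a′ Ya≈Ya′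

  lineAt-injective : ∀ V V′ b b′ → SameLine (lineAt V b) (lineAt V′ b′) → V ≡ V′ × b ≡ b′
  lineAt-injective (just j) (just j′) b b′ (xⱼ≈xⱼ′ , Yb≈Yb′) = cong just (x-injective j j′ xⱼ≈xⱼ′) , Y-injective b b′ Yb≈Yb′
  lineAt-injective nothing  nothing   b b′ Yb≈Yb′            = refl , Y-injective b b′ Yb≈Yb′
  lineAt-injective (just j) nothing   b b′ (lift ())
  lineAt-injective nothing (just j′)  b b′ (lift ())

  j2-free : J2Free (L R (suc N) x y)
  j2-free (i₁ , a₁) (i₂ , a₂) (j₁ , b₁) (j₂ , b₂) r₁≢r₂ c₁≢c₂ (e₁₁ , e₁₂ , e₂₁ , e₂₂) =
    r₁≢r₂ (view-pair-injective (pointAt-injective (view i₁) (view i₂) a₁ a₂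
      (distinct-lines-meet-once (lineAt (view j₁) b₁) (lineAt (view j₂) b₂) lines-distinct
        (incident (view i₁) (view j₁) e₁₁) (incident (view i₁) (view j₂) e₁₂)
        (incident (view i₂) (view j₁) e₂₁) (incident (view i₂) (view j₂) e₂₂))))
    where
    lines-distinct : ¬ SameLine (lineAt (view j₁) b₁) (lineAt (view j₂) b₂)
    lines-distinct = c₁≢c₂ ∘ view-pair-injective ∘ lineAt-injective (view j₁) (view j₂) b₁ b₂

mainTheorem7 : ∀ {c ℓ} (q : ℕ) → IsPrimePower q →
    (R : CommutativeRing c ℓ) → IsField R →
    (x : Fin q → CommutativeRing.Carrier R) → IsLabelling R q x →
    (y : CommutativeRing.Carrier R) → IsGenerator R y →
    J2Free (L R q x y)
-- For q = 0 the blow-up has no rows; otherwise q = N + 1 and the scheme is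
-- the incidence structure above.
mainTheorem7 zero    _ R _       x _        y _           (_ , ()) _ _ _ _ _
mainTheorem7 (suc N) _ R isField x x-labels y y-generates =
  BlowUpGeometry.j2-free R isField N x x-labels y y-generates
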